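{- Let $G$ be a finite abelian group and let $S$ be a generating set of $G$ with $0\in S$ and $|S|\ge 3$. Assume that $|(S+g)\cap S|\le 2$ for all $g\in G\setminus\{0\}$. Then $\kappa_1(S)=|S|-1$. In particular, $\kappa_1(X)=|X|-1$ for every Sidon set $X$ containing $0$.
   Context: For $S\subseteq G$ with $0\in S$, $\langle S\rangle$ is the subgroup generated by $S$. $S$ is $1$-separable if there is nonempty $X\subseteq\langle S\rangle$ with $|X+S|\le|\langle S\rangle|-1$, in which case $\kappa_1(S)=\min\{|X+S|-|X| : X\subseteq\langle S\rangle,\ |X|\ge1,\ |X+S|\le|\langle S\rangle|-1\}$; if $S$ is not $1$-separable, by convention $\kappa_1(S)=|S|-1$. A Sidon set is a set in which no two distinct unordered pairs of (not necessarily distinct) elements have the same sum. -}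

module Defs where

open import Data.Nat using (ℕ; _≤_; _∸_; _<_)
open import Data.Fin using (Fin)
open import Data.Fin.Properties using (any?; _≟_)
open import Data.Fin.Subset using (Subset; _∈_; _⊆_; ∣_∣; ⁅_⁆; _∩_; ⊤)
open import Data.Fin.Subset.Properties using (_∈?_)
open import Data.Vec using (tabulate)
open import Data.Product using (Σ; ∃; _×_; _,_)
open import Data.Sum using (_⊎_)
open import Relation.Nullary using (¬_)
open import Relation.Nullary.Decidable using (⌊_⌋; _×-dec_)
open import Relation.Binary.PropositionalEquality using (_≡_)
open import Algebra.Structures using (IsAbelianGroup)

-- A finite abelian group of order n, presented (up to isomorphism) on the
-- carrier Fin n with propositional equality.
record FinAbGroup (n : ℕ) : Set where
  field
    _+_ : Fin n → Fin n → Fin n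
    0g  : Fin n
    -_  : Fin n → Fin n
    isAbelianGroup : IsAbelianGroup _≡_ _+_ 0g -_
  infixl 6 _+_

module _ {n : ℕ} (G : FinAbGroup n) where
  open FinAbGroup G

  sumset : Subset n → Subset n → Subset n
  sumset X S = tabulate λ z →
    ⌊ any? (λ x → any? (λ s → (x ∈? X) ×-dec ((s ∈? S) ×-dec ((x + s) ≟ z)))) ⌋

  translate : Subset n → Fin n → Subset n
  translate S g = sumset S ⁅ g ⁆

  IsSubgroup : Subset n → Set
  IsSubgroup H = (0g ∈ H)
               × (∀ {x y} → x ∈ H → y ∈ H → (x + y) ∈ H)
               × (∀ {x} → x ∈ H → (- x) ∈ H)

  IsGeneratedBy : Subset n → Subset n → Set
  IsGeneratedBy S H = IsSubgroup H × S ⊆ H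
                    × (∀ K → IsSubgroup K → S ⊆ K → H ⊆ K)

  Generates : Subset n → Set
  Generates S = IsGeneratedBy S ⊤

  Admissible : Subset n → Subset n → Subset n → Set
  Admissible S H X = X ⊆ H × 1 ≤ ∣ X ∣ × ∣ sumset X S ∣ ≤ ∣ H ∣ ∸ 1

  OneSeparable : Subset n → Subset n → Set
  OneSeparable S H = ∃ λ X → Admissible S H X

  -- Kappa1 S H k : "κ₁(S) = k", where H = ⟨S⟩ and 0 ∈ S
  -- (so |X + S| ≥ |X| and truncated subtraction is exact).
  Kappa1 : Subset n → Subset n → ℕ → Set
  Kappa1 S H k =
      (OneSeparable S H
        × (∃ λ X → Admissible S H X × ∣ sumset X S ∣ ∸ ∣ X ∣ ≡ k)
        × (∀ X → Admissible S H X → k ≤ ∣ sumset X S ∣ ∸ ∣ X ∣))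
    ⊎ (¬ OneSeparable S H × k ≡ ∣ S ∣ ∸ 1)

  IsSidon : Subset n → Set
  IsSidon X = ∀ {a b c d} → a ∈ X → b ∈ X → c ∈ X → d ∈ X →
    a + b ≡ c + d → (a ≡ c × b ≡ d) ⊎ (a ≡ d × b ≡ c)

{-# OPTIONS --safe #-}
-- Call a nonempty X ⊆ H = ⟨S⟩ with X + S ≠ H a fragment, and ∂X = |X + S| - |X| its boundary;
-- κ₁(S) is the least boundary of a fragment. An atom is a fragment of least boundary and, among
-- those, of least size. Submodularity, |(A ∪ B) + S| + |(A ∩ B) + S| ≤ |A + S| + |B + S|, together
-- with the dual -(H ∖ (B + S)) of a fragment B (again a fragment, of no larger boundary) shows that
-- two atoms that meet coincide. Translates of atoms are atoms, so an atom A containing 0 is a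
-- subgroup. If |A| < |S|, the translates a + S (a ∈ A) pairwise share at most two points, so
-- |A + S| ≥ |A||S| - |A|(|A| - 1), which forces ∂A ≥ |S| - 1. Otherwise either some s ∈ S lies
-- outside A, and then A and A + s are disjoint inside A + S, so ∂A ≥ |A| ≥ |S|; or S ⊆ A, which is
-- impossible since A would contain H. Hence every fragment has boundary at least |S| - 1, and {0}
-- attains it. A Sidon set meets each of its nontrivial translates in at most one point.
module Submission where

open import Defs
open import Data.Nat using (ℕ; _≤_; _∸_)
open import Data.Fin.Subset using (Subset; _∈_; ∣_∣; _∩_; ⊤)
open import Data.Product using (_×_)
open import Relation.Nullary using (¬_)
open import Relation.Binary.PropositionalEquality using (_≡_)

open import Level using (0ℓ)
open import Algebra.Bundles using (Group; AbelianGroup)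
import Algebra.Properties.AbelianGroup as AbelianGroupProperties
import Algebra.Properties.CommutativeSemigroup as CommutativeSemigroupProperties
open import Data.Bool using (true; false; if_then_else_)
open import Data.Nat using (zero; suc; _+_; _*_; _<_; z≤n; s≤s; _≤?_; _<?_)
open import Data.Nat.Properties
open import Data.Nat.Combinatorics using (_C_; nC1≡n; nCk+nC[k+1]≡[n+1]C[k+1])
open import Data.Nat.Induction using (<-wellFounded)
open import Data.Nat.Tactic.RingSolver using (solve-∀)
open import Data.Fin as Fin using (Fin)
open import Data.Fin.Permutation using (Permutation; _⟨$⟩ʳ_; permutation)
open import Data.Fin.Subset
  using (Side; inside; outside; _∉_; _⊆_; _∪_; _─_; _-_; ⁅_⁆; Empty; Nonempty)
open import Data.Fin.Subset.Properties
open import Data.Vec using (_∷_; []; here; there; tabulate; lookup)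
open import Data.Vec.Properties using (lookup∘tabulate; tabulate∘lookup; []=⇒lookup; lookup⇒[]=)
open import Data.Product using (∃; ∃₂; ∃-syntax; _,_; proj₁; proj₂)
open import Data.Sum using (inj₁; inj₂; [_,_])
open import Function using (_∘_)
open import Induction.WellFounded using (Acc; acc)
open import Relation.Nullary using (Dec; yes; no; contradiction; _×-dec_)
open import Relation.Nullary.Decidable using (⌊_⌋)
open import Relation.Unary using (Pred; Decidable)
open import Relation.Binary.PropositionalEquality
  using (_≢_; refl; sym; trans; cong; cong₂; subst; module ≡-Reasoning)

open import Algebra.Properties.CommutativeMonoid.Sum +-0-commutativeMonoid using (sum; sum-permute)
open CommutativeSemigroupProperties +-commutativeSemigroup using ()
  renaming (interchange to +-interchange; xy∙z≈xz∙y to +-rightComm; x∙yz≈yx∙z to +-leftRegroup)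

private
  variable
    m n : ℕ

2*[1+nC2]≡[1+n]*n : ∀ n → 2 * (suc n C 2) ≡ suc n * n
2*[1+nC2]≡[1+n]*n zero    = refl
2*[1+nC2]≡[1+n]*n (suc n) = begin
  2 * (suc (suc n) C 2)         ≡⟨ cong (2 *_) (nCk+nC[k+1]≡[n+1]C[k+1] (suc n) 1) ⟨
  2 * (suc n C 1 + suc n C 2)   ≡⟨ cong (λ m → 2 * (m + suc n C 2)) (nC1≡n (suc n)) ⟩
  2 * (suc n + suc n C 2)       ≡⟨ *-distribˡ-+ 2 (suc n) (suc n C 2) ⟩
  2 * suc n + 2 * (suc n C 2)   ≡⟨ cong (2 * suc n +_) (2*[1+nC2]≡[1+n]*n n) ⟩
  2 * suc n + suc n * n         ≡⟨ regroup n ⟩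
  suc (suc n) * suc n           ∎
  where
  open ≡-Reasoning
  regroup : ∀ n → 2 * suc n + suc n * n ≡ suc (suc n) * suc n
  regroup = solve-∀

-- As 2 (a C 2) = a (a - 1), the hypothesis says a (s - a) ≤ k, and a (s - a) ≥ s - 1 when 1 ≤ a < s.
a*s≤a+k+2*[aC2]⇒s≤1+k : ∀ {a s k} → 0 < a → a < s → a * s ≤ a + k + 2 * (a C 2) → s ≤ suc k
a*s≤a+k+2*[aC2]⇒s≤1+k {suc a} {s} {k} _ a<s bound with m≤n⇒∃[o]m+o≡n a<s
... | e , refl = s≤s (begin
  suc a + e                 ≤⟨ +-monoʳ-≤ (suc a) (m≤n*m e (suc a)) ⟩
  suc a + suc a * e         ≤⟨ +-cancelˡ-≤ (suc a + suc a * a) _ _ (begin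
    suc a + suc a * a + (suc a + suc a * e) ≡⟨ expand a e ⟨
    suc a * (suc (suc a) + e)               ≤⟨ bound ⟩
    suc a + k + 2 * (suc a C 2)             ≡⟨ cong (suc a + k +_) (2*[1+nC2]≡[1+n]*n a) ⟩
    suc a + k + suc a * a                   ≡⟨ +-rightComm (suc a) k (suc a * a) ⟩
    suc a + suc a * a + k                   ∎) ⟩
  k                         ∎)
  where
  open ≤-Reasoning
  expand : ∀ a e → suc a * (suc (suc a) + e) ≡ suc a + suc a * a + (suc a + suc a * e)
  expand = solve-∀

m≤n∸1⇒m<n : ∀ {m n} → 0 < m → m ≤ n ∸ 1 → m < n
m≤n∸1⇒m<n {n = zero}  0<m m≤0 = contradiction (<-≤-trans 0<m m≤0) (n≮0 {0})
m≤n∸1⇒m<n {n = suc n} _   m≤n = s≤s m≤n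

∣p∪q∣+∣p∩q∣≡∣p∣+∣q∣ : ∀ (p q : Subset n) → ∣ p ∪ q ∣ + ∣ p ∩ q ∣ ≡ ∣ p ∣ + ∣ q ∣
∣p∪q∣+∣p∩q∣≡∣p∣+∣q∣ []            []            = refl
∣p∪q∣+∣p∩q∣≡∣p∣+∣q∣ (inside  ∷ p) (inside  ∷ q) =
  cong suc (trans (+-suc _ _) (trans (cong suc (∣p∪q∣+∣p∩q∣≡∣p∣+∣q∣ p q)) (sym (+-suc _ _))))
∣p∪q∣+∣p∩q∣≡∣p∣+∣q∣ (inside  ∷ p) (outside ∷ q) = cong suc (∣p∪q∣+∣p∩q∣≡∣p∣+∣q∣ p q)
∣p∪q∣+∣p∩q∣≡∣p∣+∣q∣ (outside ∷ p) (inside  ∷ q) =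
  trans (cong suc (∣p∪q∣+∣p∩q∣≡∣p∣+∣q∣ p q)) (sym (+-suc _ _))
∣p∪q∣+∣p∩q∣≡∣p∣+∣q∣ (outside ∷ p) (outside ∷ q) = ∣p∪q∣+∣p∩q∣≡∣p∣+∣q∣ p q

∣p∩q∣+∣p─q∣≡∣p∣ : ∀ (p q : Subset n) → ∣ p ∩ q ∣ + ∣ p ─ q ∣ ≡ ∣ p ∣
∣p∩q∣+∣p─q∣≡∣p∣ []            []            = refl
∣p∩q∣+∣p─q∣≡∣p∣ (inside  ∷ p) (inside  ∷ q) = cong suc (∣p∩q∣+∣p─q∣≡∣p∣ p q)
∣p∩q∣+∣p─q∣≡∣p∣ (inside  ∷ p) (outside ∷ q) = trans (+-suc _ _) (cong suc (∣p∩q∣+∣p─q∣≡∣p∣ p q))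
∣p∩q∣+∣p─q∣≡∣p∣ (outside ∷ p) (inside  ∷ q) = ∣p∩q∣+∣p─q∣≡∣p∣ p q
∣p∩q∣+∣p─q∣≡∣p∣ (outside ∷ p) (outside ∷ q) = ∣p∩q∣+∣p─q∣≡∣p∣ p q

∣p∪q∣≤∣p∣+∣q∣ : ∀ (p q : Subset n) → ∣ p ∪ q ∣ ≤ ∣ p ∣ + ∣ q ∣
∣p∪q∣≤∣p∣+∣q∣ p q = m+n≤o⇒m≤o _ (≤-reflexive (∣p∪q∣+∣p∩q∣≡∣p∣+∣q∣ p q))

Empty⇒∣p∣≡0 : ∀ {p : Subset n} → Empty p → ∣ p ∣ ≡ 0
Empty⇒∣p∣≡0 {n} p-empty = trans (cong ∣_∣ (Empty-unique p-empty)) (∣⊥∣≡0 n)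

x∈p⇒⁅x⁆⊆p : ∀ {p : Subset n} {x} → x ∈ p → ⁅ x ⁆ ⊆ p
x∈p⇒⁅x⁆⊆p {p = p} {x} x∈p y∈⁅x⁆ = subst (_∈ p) (sym (x∈⁅y⁆⇒x≡y x y∈⁅x⁆)) x∈p

Nonempty⇒∣p∣>0 : ∀ {p : Subset n} → Nonempty p → 0 < ∣ p ∣
Nonempty⇒∣p∣>0 {p = p} (x , x∈p) = begin-strict
  0         <⟨ s≤s z≤n ⟩
  1         ≡⟨ ∣⁅x⁆∣≡1 x ⟨
  ∣ ⁅ x ⁆ ∣ ≤⟨ p⊆q⇒∣p∣≤∣q∣ (x∈p⇒⁅x⁆⊆p x∈p) ⟩
  ∣ p ∣     ∎
  where open ≤-Reasoning

∣p∣>0⇒Nonempty : ∀ {p : Subset n} → 0 < ∣ p ∣ → Nonempty p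
∣p∣>0⇒Nonempty {p = p} ∣p∣>0 with nonempty? p
... | yes p-nonempty = p-nonempty
... | no  p-empty    = contradiction (Empty⇒∣p∣≡0 p-empty) (>⇒≢ ∣p∣>0)

disjoint⇒∣p∣+∣q∣≤∣r∣ : ∀ {p q r : Subset n} → p ⊆ r → q ⊆ r → Empty (p ∩ q) → ∣ p ∣ + ∣ q ∣ ≤ ∣ r ∣
disjoint⇒∣p∣+∣q∣≤∣r∣ {p = p} {q} {r} p⊆r q⊆r p∩q-empty = begin
  ∣ p ∣ + ∣ q ∣             ≡⟨ ∣p∪q∣+∣p∩q∣≡∣p∣+∣q∣ p q ⟨
  ∣ p ∪ q ∣ + ∣ p ∩ q ∣     ≡⟨ cong (∣ p ∪ q ∣ +_) (Empty⇒∣p∣≡0 p∩q-empty) ⟩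
  ∣ p ∪ q ∣ + 0             ≡⟨ +-identityʳ _ ⟩
  ∣ p ∪ q ∣                 ≤⟨ p⊆q⇒∣p∣≤∣q∣ (λ x∈p∪q → [ p⊆r , q⊆r ] (x∈p∪q⁻ p q x∈p∪q)) ⟩
  ∣ r ∣                     ∎
  where open ≤-Reasoning

∣q∣+∣p─q∣≡∣p∣ : ∀ {p q : Subset n} → q ⊆ p → ∣ q ∣ + ∣ p ─ q ∣ ≡ ∣ p ∣
∣q∣+∣p─q∣≡∣p∣ {p = p} {q} q⊆p = begin
  ∣ q ∣ + ∣ p ─ q ∣       ≡⟨ cong (λ r → ∣ r ∣ + ∣ p ─ q ∣) p∩q≡q ⟨
  ∣ p ∩ q ∣ + ∣ p ─ q ∣   ≡⟨ ∣p∩q∣+∣p─q∣≡∣p∣ p q ⟩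
  ∣ p ∣                   ∎
  where
  open ≡-Reasoning
  p∩q≡q : p ∩ q ≡ q
  p∩q≡q = ⊆-antisym (p∩q⊆q p q) (λ x∈q → x∈p∩q⁺ (q⊆p x∈q , x∈q))

x∈p⇒suc∣p-x∣≡∣p∣ : ∀ {p : Subset n} {x} → x ∈ p → suc ∣ p - x ∣ ≡ ∣ p ∣
x∈p⇒suc∣p-x∣≡∣p∣ {p = p} {x} x∈p =
  trans (cong (_+ ∣ p - x ∣) (sym (∣⁅x⁆∣≡1 x))) (∣q∣+∣p─q∣≡∣p∣ (x∈p⇒⁅x⁆⊆p x∈p))

x∈p─q⇒x∉q : ∀ {p q : Subset n} {x} → x ∈ p ─ q → x ∉ q
x∈p─q⇒x∉q {p = _ ∷ _} {outside ∷ _} here          ()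
x∈p─q⇒x∉q {p = _ ∷ _} {_ ∷ _}       (there x∈p─q) (there x∈q) = x∈p─q⇒x∉q x∈p─q x∈q

x∈p-y⇒x≢y : ∀ {p : Subset n} {x y} → x ∈ p - y → x ≢ y
x∈p-y⇒x≢y x∈p-y refl = x∈p─q⇒x∉q x∈p-y (x∈⁅x⁆ _)

subsingleton⇒∣p∣≤1 : ∀ {p : Subset n} → (∀ {x y} → x ∈ p → y ∈ p → x ≡ y) → ∣ p ∣ ≤ 1
subsingleton⇒∣p∣≤1 {p = p} unique with nonempty? p
... | no  p-empty   = ≤-trans (≤-reflexive (Empty⇒∣p∣≡0 p-empty)) z≤n
... | yes (x , x∈p) = begin
  ∣ p ∣     ≤⟨ p⊆q⇒∣p∣≤∣q∣ (λ y∈p → subst (_∈ ⁅ x ⁆) (unique x∈p y∈p) (x∈⁅x⁆ x)) ⟩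
  ∣ ⁅ x ⁆ ∣ ≡⟨ ∣⁅x⁆∣≡1 x ⟩
  1         ∎
  where open ≤-Reasoning

p⊆q∧∣q∣≤∣p∣⇒p≡q : ∀ {p q : Subset n} → p ⊆ q → ∣ q ∣ ≤ ∣ p ∣ → p ≡ q
p⊆q∧∣q∣≤∣p∣⇒p≡q {p = p} p⊆q ∣q∣≤∣p∣ = ⊆-antisym p⊆q q⊆p
  where
  q⊆p : _ ⊆ p
  q⊆p {x} x∈q with x ∈? p
  ... | yes x∈p = x∈p
  ... | no  x∉p = contradiction ∣q∣≤∣p∣ (<⇒≱ (p⊂q⇒∣p∣<∣q∣ (p⊆q , x , x∈q , x∉p)))

∈-tabulate⁺ : ∀ {P : Pred (Fin n) 0ℓ} (P? : Decidable P) {x} → P x → x ∈ tabulate (λ y → ⌊ P? y ⌋)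
∈-tabulate⁺ P? {x} Px = lookup⇒[]= x _ (trans (lookup∘tabulate (λ y → ⌊ P? y ⌋) x) ⌊P?x⌋≡true)
  where
  ⌊P?x⌋≡true : ⌊ P? x ⌋ ≡ true
  ⌊P?x⌋≡true with P? x
  ... | yes _  = refl
  ... | no ¬Px = contradiction Px ¬Px

∈-tabulate⁻ : ∀ {P : Pred (Fin n) 0ℓ} (P? : Decidable P) {x} → x ∈ tabulate (λ y → ⌊ P? y ⌋) → P x
∈-tabulate⁻ P? {x} x∈p with P? x | trans (sym (lookup∘tabulate (λ y → ⌊ P? y ⌋) x)) ([]=⇒lookup x∈p)
... | yes Px | _  = Px
... | no  _  | ()

preimage : (Fin m → Fin n) → Subset n → Subset m
preimage f p = tabulate (lookup p ∘ f)

∈-preimage⁺ : ∀ {f : Fin m → Fin n} {p x} → f x ∈ p → x ∈ preimage f p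
∈-preimage⁺ {f = f} {p} {x} fx∈p =
  lookup⇒[]= x _ (trans (lookup∘tabulate (lookup p ∘ f) x) ([]=⇒lookup fx∈p))

∈-preimage⁻ : ∀ {f : Fin m → Fin n} {p x} → x ∈ preimage f p → f x ∈ p
∈-preimage⁻ {f = f} {p} {x} x∈f⁻¹p =
  lookup⇒[]= (f x) p (trans (sym (lookup∘tabulate (lookup p ∘ f) x)) ([]=⇒lookup x∈f⁻¹p))

∣tabulate∣≡sum : ∀ (f : Fin n → Side) → ∣ tabulate f ∣ ≡ sum (λ i → if f i then 1 else 0)
∣tabulate∣≡sum {zero}  f = refl
∣tabulate∣≡sum {suc n} f with f Fin.zero
... | true  = cong suc (∣tabulate∣≡sum (f ∘ Fin.suc))
... | false = ∣tabulate∣≡sum (f ∘ Fin.suc)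

∣preimage∣≡∣p∣ : ∀ (π : Permutation m n) (p : Subset n) → ∣ preimage (π ⟨$⟩ʳ_) p ∣ ≡ ∣ p ∣
∣preimage∣≡∣p∣ π p = begin
  ∣ preimage (π ⟨$⟩ʳ_) p ∣                              ≡⟨ ∣tabulate∣≡sum (lookup p ∘ (π ⟨$⟩ʳ_)) ⟩
  sum ((λ i → if lookup p i then 1 else 0) ∘ (π ⟨$⟩ʳ_)) ≡⟨ sum-permute _ π ⟨
  sum (λ i → if lookup p i then 1 else 0)               ≡⟨ ∣tabulate∣≡sum (lookup p) ⟨
  ∣ tabulate (lookup p) ∣                               ≡⟨ cong ∣_∣ (tabulate∘lookup p) ⟩
  ∣ p ∣                                                 ∎
  where open ≡-Reasoning

argmin : ∀ {ℓ} {P : Pred (Subset n) ℓ} → Decidable P → (μ : Subset n → ℕ) →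
         ∀ {X} → P X → ∃[ A ] P A × (∀ {Y} → P Y → μ A ≤ μ Y)
argmin {P = P} P? μ {X} PX = go PX (<-wellFounded (μ X))
  where
  go : ∀ {X} → P X → Acc _<_ (μ X) → ∃[ A ] P A × (∀ {Y} → P Y → μ A ≤ μ Y)
  go {X} PX (acc rs) with anySubset? (λ Y → P? Y ×-dec μ Y <? μ X)
  ... | yes (Y , PY , μY<μX) = go PY (rs μY<μX)
  ... | no  ∄smaller         = X , PX , λ PY → ≮⇒≥ (λ μY<μX → ∄smaller (_ , PY , μY<μX))

removal-induction : ∀ {ℓ} (P : Pred (Subset n) ℓ) → (∀ {p} → Empty p → P p) →
                    (∀ {p x} → x ∈ p → P (p - x) → P p) → ∀ p → P p
removal-induction P base step p = go p (<-wellFounded ∣ p ∣)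
  where
  go : ∀ p → Acc _<_ ∣ p ∣ → P p
  go p (acc rs) with nonempty? p
  ... | no  p-empty   = base p-empty
  ... | yes (x , x∈p) = step x∈p (go (p - x) (rs (x∈p⇒∣p-x∣<∣p∣ x∈p)))

abelianGroup : FinAbGroup n → AbelianGroup 0ℓ 0ℓ
abelianGroup G = record { isAbelianGroup = FinAbGroup.isAbelianGroup G }

module Sumsets {n} (G : FinAbGroup n) where

  open AbelianGroup (abelianGroup G)
    using (_∙_; ε; _⁻¹; comm; assoc; identityˡ; identityʳ; group; commutativeSemigroup)
  open Group group using (_//_)
  open AbelianGroupProperties (abelianGroup G)
  open CommutativeSemigroupProperties commutativeSemigroup using (xy∙z≈xz∙y; x∙yz≈y∙xz)

  infixl 6 _⊕_
  _⊕_ : Subset n → Subset n → Subset n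
  _⊕_ = sumset G

  ∈-sumset⁺ : ∀ {X Y x y} → x ∈ X → y ∈ Y → x ∙ y ∈ X ⊕ Y
  ∈-sumset⁺ x∈X y∈Y = ∈-tabulate⁺ _ (_ , _ , x∈X , y∈Y , refl)

  ∈-sumset⁻ : ∀ {X Y z} → z ∈ X ⊕ Y → ∃₂ λ x y → x ∈ X × y ∈ Y × x ∙ y ≡ z
  ∈-sumset⁻ = ∈-tabulate⁻ _

  ⊕-monoˡ : ∀ {X X′ Y} → X ⊆ X′ → X ⊕ Y ⊆ X′ ⊕ Y
  ⊕-monoˡ X⊆X′ z∈X⊕Y with ∈-sumset⁻ z∈X⊕Y
  ... | x , y , x∈X , y∈Y , refl = ∈-sumset⁺ (X⊆X′ x∈X) y∈Y

  ⊕-monoʳ : ∀ {X Y Y′} → Y ⊆ Y′ → X ⊕ Y ⊆ X ⊕ Y′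
  ⊕-monoʳ Y⊆Y′ z∈X⊕Y with ∈-sumset⁻ z∈X⊕Y
  ... | x , y , x∈X , y∈Y , refl = ∈-sumset⁺ x∈X (Y⊆Y′ y∈Y)

  X⊆X⊕Y : ∀ {X Y} → ε ∈ Y → X ⊆ X ⊕ Y
  X⊆X⊕Y ε∈Y {x} x∈X = subst (_∈ _) (identityʳ x) (∈-sumset⁺ x∈X ε∈Y)

  ⁅ε⁆⊕Y≡Y : ∀ Y → ⁅ ε ⁆ ⊕ Y ≡ Y
  ⁅ε⁆⊕Y≡Y Y = ⊆-antisym ⁅ε⁆⊕Y⊆Y (λ {y} y∈Y → subst (_∈ ⁅ ε ⁆ ⊕ Y) (identityˡ y) (∈-sumset⁺ (x∈⁅x⁆ ε) y∈Y))
    where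
    ⁅ε⁆⊕Y⊆Y : ⁅ ε ⁆ ⊕ Y ⊆ Y
    ⁅ε⁆⊕Y⊆Y z∈ with ∈-sumset⁻ z∈
    ... | e , y , e∈⁅ε⁆ , y∈Y , refl with x∈⁅y⁆⇒x≡y ε e∈⁅ε⁆
    ...   | refl = subst (_∈ Y) (sym (identityˡ y)) y∈Y

  Empty-⊕ : ∀ {X} Y → Empty X → Empty (X ⊕ Y)
  Empty-⊕ Y X-empty (z , z∈X⊕Y) with ∈-sumset⁻ z∈X⊕Y
  ... | x , _ , x∈X , _ = X-empty (x , x∈X)

  ⊕-swapʳ : ∀ X Y Z → (X ⊕ Y) ⊕ Z ≡ (X ⊕ Z) ⊕ Y
  ⊕-swapʳ X Y Z = ⊆-antisym (swap X Y Z) (swap X Z Y)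
    where
    swap : ∀ X Y Z → (X ⊕ Y) ⊕ Z ⊆ (X ⊕ Z) ⊕ Y
    swap X Y Z w∈XYZ with ∈-sumset⁻ w∈XYZ
    ... | _ , z , xy∈XY , z∈Z , refl with ∈-sumset⁻ xy∈XY
    ...   | x , y , x∈X , y∈Y , refl =
      subst (_∈ (X ⊕ Z) ⊕ Y) (sym (xy∙z≈xz∙y x y z)) (∈-sumset⁺ (∈-sumset⁺ x∈X z∈Z) y∈Y)

  ∪-⊕ : ∀ X Y Z → (X ∪ Y) ⊕ Z ≡ (X ⊕ Z) ∪ (Y ⊕ Z)
  ∪-⊕ X Y Z = ⊆-antisym split merge
    where
    split : (X ∪ Y) ⊕ Z ⊆ (X ⊕ Z) ∪ (Y ⊕ Z)
    split w∈ with ∈-sumset⁻ w∈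
    ... | x , z , x∈X∪Y , z∈Z , refl with x∈p∪q⁻ X Y x∈X∪Y
    ...   | inj₁ x∈X = x∈p∪q⁺ (inj₁ (∈-sumset⁺ x∈X z∈Z))
    ...   | inj₂ x∈Y = x∈p∪q⁺ (inj₂ (∈-sumset⁺ x∈Y z∈Z))
    merge : (X ⊕ Z) ∪ (Y ⊕ Z) ⊆ (X ∪ Y) ⊕ Z
    merge w∈ = [ ⊕-monoˡ (p⊆p∪q Y) , ⊕-monoˡ (q⊆p∪q X Y) ] (x∈p∪q⁻ _ _ w∈)

  submodular : ∀ X Y Z → ∣ (X ∪ Y) ⊕ Z ∣ + ∣ (X ∩ Y) ⊕ Z ∣ ≤ ∣ X ⊕ Z ∣ + ∣ Y ⊕ Z ∣
  submodular X Y Z = begin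
    ∣ (X ∪ Y) ⊕ Z ∣ + ∣ (X ∩ Y) ⊕ Z ∣             ≡⟨ cong (λ U → ∣ U ∣ + ∣ (X ∩ Y) ⊕ Z ∣) (∪-⊕ X Y Z) ⟩
    ∣ (X ⊕ Z) ∪ (Y ⊕ Z) ∣ + ∣ (X ∩ Y) ⊕ Z ∣       ≤⟨ +-monoʳ-≤ _ (p⊆q⇒∣p∣≤∣q∣ ∩-⊕) ⟩
    ∣ (X ⊕ Z) ∪ (Y ⊕ Z) ∣ + ∣ (X ⊕ Z) ∩ (Y ⊕ Z) ∣ ≡⟨ ∣p∪q∣+∣p∩q∣≡∣p∣+∣q∣ (X ⊕ Z) (Y ⊕ Z) ⟩
    ∣ X ⊕ Z ∣ + ∣ Y ⊕ Z ∣                         ∎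
    where
    open ≤-Reasoning
    ∩-⊕ : (X ∩ Y) ⊕ Z ⊆ (X ⊕ Z) ∩ (Y ⊕ Z)
    ∩-⊕ w∈ = x∈p∩q⁺ (⊕-monoˡ (p∩q⊆p X Y) w∈ , ⊕-monoˡ (p∩q⊆q X Y) w∈)

  ∈-translate⁺ : ∀ {X x} c → x ∈ X → x ∙ c ∈ translate G X c
  ∈-translate⁺ c x∈X = ∈-sumset⁺ x∈X (x∈⁅x⁆ c)

  ∈-translate⁻ : ∀ {X z c} → z ∈ translate G X c → z // c ∈ X
  ∈-translate⁻ {c = c} z∈X+c with ∈-sumset⁻ z∈X+c
  ... | x , c′ , x∈X , c′∈⁅c⁆ , refl with x∈⁅y⁆⇒x≡y c c′∈⁅c⁆
  ...   | refl = subst (_∈ _) (sym (//-rightDividesʳ c x)) x∈X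

  translate≡preimage : ∀ X c → translate G X c ≡ preimage (_// c) X
  translate≡preimage X c = ⊆-antisym
    (λ z∈X+c → ∈-preimage⁺ (∈-translate⁻ z∈X+c))
    (λ {z} z∈ → subst (_∈ translate G X c) (//-rightDividesˡ c z) (∈-translate⁺ c (∈-preimage⁻ z∈)))

  ∣translate∣ : ∀ X c → ∣ translate G X c ∣ ≡ ∣ X ∣
  ∣translate∣ X c = trans (cong ∣_∣ (translate≡preimage X c)) (∣preimage∣≡∣p∣ π X)
    where
    π : Permutation n n
    π = permutation (_// c) (_∙ c) (//-rightDividesʳ c) (//-rightDividesˡ c)

  ∣translate⊕∣ : ∀ X Y c → ∣ translate G X c ⊕ Y ∣ ≡ ∣ X ⊕ Y ∣
  ∣translate⊕∣ X Y c = trans (cong ∣_∣ (⊕-swapʳ X ⁅ c ⁆ Y)) (∣translate∣ (X ⊕ Y) c)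

  ⊖_ : Subset n → Subset n
  ⊖ X = preimage _⁻¹ X

  ∣⊖X∣≡∣X∣ : ∀ X → ∣ ⊖ X ∣ ≡ ∣ X ∣
  ∣⊖X∣≡∣X∣ = ∣preimage∣≡∣p∣ (permutation _⁻¹ _⁻¹ ⁻¹-involutive ⁻¹-involutive)

  ⊕-remove : ∀ {X x} Y → x ∈ X → X ⊕ Y ≡ ((X - x) ⊕ Y) ∪ translate G Y x
  ⊕-remove {X} {x} Y x∈X = ⊆-antisym split merge
    where
    split : X ⊕ Y ⊆ ((X - x) ⊕ Y) ∪ translate G Y x
    split w∈ with ∈-sumset⁻ w∈
    ... | x′ , y , x′∈X , y∈Y , refl with x′ Fin.≟ x
    ...   | yes refl = x∈p∪q⁺ (inj₂ (subst (_∈ translate G Y x) (comm y x) (∈-translate⁺ x y∈Y)))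
    ...   | no  x′≢x = x∈p∪q⁺ (inj₁ (∈-sumset⁺ (x∈p∧x≢y⇒x∈p-y x′∈X x′≢x) y∈Y))
    merge : ((X - x) ⊕ Y) ∪ translate G Y x ⊆ X ⊕ Y
    merge w∈ with x∈p∪q⁻ _ _ w∈
    ... | inj₁ w∈X-x⊕Y = ⊕-monoˡ (p─q⊆p X ⁅ x ⁆) w∈X-x⊕Y
    ... | inj₂ w∈Y+x with ∈-sumset⁻ w∈Y+x
    ...   | y , x′ , y∈Y , x′∈⁅x⁆ , refl with x∈⁅y⁆⇒x≡y x x′∈⁅x⁆
    ...     | refl = subst (_∈ X ⊕ Y) (comm x y) (∈-sumset⁺ x∈X y∈Y)

  ∣X⊕Y∩T∣≤c*∣X∣ : ∀ {c} Y T X → (∀ {x} → x ∈ X → ∣ translate G Y x ∩ T ∣ ≤ c) → ∣ (X ⊕ Y) ∩ T ∣ ≤ c * ∣ X ∣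
  ∣X⊕Y∩T∣≤c*∣X∣ {c} Y T = removal-induction P base step
    where
    P : Subset n → Set
    P X = (∀ {x} → x ∈ X → ∣ translate G Y x ∩ T ∣ ≤ c) → ∣ (X ⊕ Y) ∩ T ∣ ≤ c * ∣ X ∣
    base : ∀ {X} → Empty X → P X
    base {X} X-empty _ = begin
      ∣ (X ⊕ Y) ∩ T ∣ ≤⟨ ∣p∩q∣≤∣p∣ (X ⊕ Y) T ⟩
      ∣ X ⊕ Y ∣       ≡⟨ Empty⇒∣p∣≡0 (Empty-⊕ Y X-empty) ⟩
      0               ≤⟨ z≤n ⟩
      c * ∣ X ∣       ∎
      where open ≤-Reasoning
    step : ∀ {X x} → x ∈ X → P (X - x) → P X
    step {X} {x} x∈X ih bound = begin
      ∣ (X ⊕ Y) ∩ T ∣                                   ≡⟨ cong (λ U → ∣ U ∩ T ∣) (⊕-remove Y x∈X) ⟩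
      ∣ (((X - x) ⊕ Y) ∪ Y+x) ∩ T ∣                     ≡⟨ cong ∣_∣ (∩-distribʳ-∪ T ((X - x) ⊕ Y) Y+x) ⟩
      ∣ (((X - x) ⊕ Y) ∩ T) ∪ (Y+x ∩ T) ∣               ≤⟨ ∣p∪q∣≤∣p∣+∣q∣ (((X - x) ⊕ Y) ∩ T) (Y+x ∩ T) ⟩
      ∣ ((X - x) ⊕ Y) ∩ T ∣ + ∣ Y+x ∩ T ∣               ≤⟨ +-mono-≤ (ih (bound ∘ p─q⊆p X ⁅ x ⁆)) (bound x∈X) ⟩
      c * ∣ X - x ∣ + c                                 ≡⟨ +-comm (c * ∣ X - x ∣) c ⟩
      c + c * ∣ X - x ∣                                 ≡⟨ *-suc c ∣ X - x ∣ ⟨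
      c * suc ∣ X - x ∣                                 ≡⟨ cong (c *_) (x∈p⇒suc∣p-x∣≡∣p∣ x∈X) ⟩
      c * ∣ X ∣                                         ∎
      where
      open ≤-Reasoning
      Y+x = translate G Y x

  ∣X∣*∣Y∣≤∣X⊕Y∣+c*[∣X∣C2] : ∀ {c} Y → (∀ {x x′} → x ≢ x′ → ∣ translate G Y x ∩ translate G Y x′ ∣ ≤ c) →
                             ∀ X → ∣ X ∣ * ∣ Y ∣ ≤ ∣ X ⊕ Y ∣ + c * (∣ X ∣ C 2)
  ∣X∣*∣Y∣≤∣X⊕Y∣+c*[∣X∣C2] {c} Y overlap≤c = removal-induction P base step
    where
    P : Subset n → Set
    P X = ∣ X ∣ * ∣ Y ∣ ≤ ∣ X ⊕ Y ∣ + c * (∣ X ∣ C 2)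
    base : ∀ {X} → Empty X → P X
    base X-empty rewrite Empty⇒∣p∣≡0 X-empty = z≤n
    step : ∀ {X x} → x ∈ X → P (X - x) → P X
    step {X} {x} x∈X ih = begin
      ∣ X ∣ * ∣ Y ∣                                  ≡⟨ cong (_* ∣ Y ∣) ∣X∣≡1+k ⟨
      ∣ Y ∣ + k * ∣ Y ∣                              ≤⟨ +-monoʳ-≤ ∣ Y ∣ ih ⟩
      ∣ Y ∣ + (∣ X′ ⊕ Y ∣ + c * (k C 2))             ≡⟨ +-leftRegroup ∣ Y ∣ ∣ X′ ⊕ Y ∣ (c * (k C 2)) ⟩
      ∣ X′ ⊕ Y ∣ + ∣ Y ∣ + c * (k C 2)               ≡⟨ cong (_+ c * (k C 2)) inclusion-exclusion ⟩
      ∣ X ⊕ Y ∣ + ∣ (X′ ⊕ Y) ∩ Y+x ∣ + c * (k C 2)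
        ≤⟨ +-monoˡ-≤ (c * (k C 2)) (+-monoʳ-≤ ∣ X ⊕ Y ∣ (∣X⊕Y∩T∣≤c*∣X∣ Y Y+x X′ (overlap≤c ∘ x∈p-y⇒x≢y))) ⟩
      ∣ X ⊕ Y ∣ + c * k + c * (k C 2)                ≡⟨ +-assoc ∣ X ⊕ Y ∣ (c * k) (c * (k C 2)) ⟩
      ∣ X ⊕ Y ∣ + (c * k + c * (k C 2))              ≡⟨ cong (∣ X ⊕ Y ∣ +_) (*-distribˡ-+ c k (k C 2)) ⟨
      ∣ X ⊕ Y ∣ + c * (k + k C 2)                    ≡⟨ cong (λ m → ∣ X ⊕ Y ∣ + c * m) pascal ⟩
      ∣ X ⊕ Y ∣ + c * (∣ X ∣ C 2)                    ∎
      where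
      open ≤-Reasoning
      X′ = X - x
      k = ∣ X′ ∣
      Y+x = translate G Y x
      ∣X∣≡1+k : suc k ≡ ∣ X ∣
      ∣X∣≡1+k = x∈p⇒suc∣p-x∣≡∣p∣ x∈X
      inclusion-exclusion : ∣ X′ ⊕ Y ∣ + ∣ Y ∣ ≡ ∣ X ⊕ Y ∣ + ∣ (X′ ⊕ Y) ∩ Y+x ∣
      inclusion-exclusion = begin-equality
        ∣ X′ ⊕ Y ∣ + ∣ Y ∣                       ≡⟨ cong (∣ X′ ⊕ Y ∣ +_) (∣translate∣ Y x) ⟨
        ∣ X′ ⊕ Y ∣ + ∣ Y+x ∣                     ≡⟨ ∣p∪q∣+∣p∩q∣≡∣p∣+∣q∣ (X′ ⊕ Y) Y+x ⟨
        ∣ (X′ ⊕ Y) ∪ Y+x ∣ + ∣ (X′ ⊕ Y) ∩ Y+x ∣  ≡⟨ cong (λ U → ∣ U ∣ + ∣ (X′ ⊕ Y) ∩ Y+x ∣) (⊕-remove Y x∈X) ⟨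
        ∣ X ⊕ Y ∣ + ∣ (X′ ⊕ Y) ∩ Y+x ∣           ∎
      pascal : k + k C 2 ≡ ∣ X ∣ C 2
      pascal = begin-equality
        k + k C 2      ≡⟨ cong (_+ k C 2) (nC1≡n k) ⟨
        k C 1 + k C 2  ≡⟨ nCk+nC[k+1]≡[n+1]C[k+1] k 1 ⟩
        suc k C 2      ≡⟨ cong (_C 2) ∣X∣≡1+k ⟩
        ∣ X ∣ C 2      ∎

  ∣Y+x∩Y+x′∣≤c : ∀ {c} Y → (∀ g → g ≢ ε → ∣ translate G Y g ∩ Y ∣ ≤ c) →
                 ∀ {x x′} → x ≢ x′ → ∣ translate G Y x ∩ translate G Y x′ ∣ ≤ c
  ∣Y+x∩Y+x′∣≤c {c} Y overlap≤c {x} {x′} x≢x′ = begin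
    ∣ translate G Y x ∩ translate G Y x′ ∣ ≤⟨ p⊆q⇒∣p∣≤∣q∣ ⊆translate ⟩
    ∣ translate G (Y+g ∩ Y) x′ ∣         ≡⟨ ∣translate∣ (Y+g ∩ Y) x′ ⟩
    ∣ Y+g ∩ Y ∣                         ≤⟨ overlap≤c (x // x′) (x≢x′ ∘ x∙y⁻¹≈ε⇒x≈y x x′) ⟩
    c                                   ∎
    where
    open ≤-Reasoning
    Y+g = translate G Y (x // x′)
    telescope : ∀ z → (z // x) ∙ (x // x′) ≡ z // x′
    telescope z = trans (sym (assoc (z // x) x (x′ ⁻¹))) (cong (_∙ x′ ⁻¹) (//-rightDividesˡ x z))
    ⊆translate : translate G Y x ∩ translate G Y x′ ⊆ translate G (Y+g ∩ Y) x′
    ⊆translate {z} z∈ with x∈p∩q⁻ (translate G Y x) (translate G Y x′) z∈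
    ... | z∈Y+x , z∈Y+x′ = subst (_∈ translate G (Y+g ∩ Y) x′) (//-rightDividesˡ x′ z)
      (∈-translate⁺ x′ (x∈p∩q⁺ ( subst (_∈ Y+g) (telescope z) (∈-translate⁺ (x // x′) (∈-translate⁻ z∈Y+x))
                               , ∈-translate⁻ z∈Y+x′)))

  Sidon⇒∣X+g∩X∣≤1 : ∀ {X g} → IsSidon G X → g ≢ ε → ∣ translate G X g ∩ X ∣ ≤ 1
  Sidon⇒∣X+g∩X∣≤1 {X} {g} sidon g≢ε = subsingleton⇒∣p∣≤1 unique
    where
    unique : ∀ {z w} → z ∈ translate G X g ∩ X → w ∈ translate G X g ∩ X → z ≡ w
    unique {z} {w} z∈ w∈ with x∈p∩q⁻ (translate G X g) X z∈ | x∈p∩q⁻ (translate G X g) X w∈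
    ... | z∈X+g , z∈X | w∈X+g , w∈X
      with sidon z∈X (∈-translate⁻ w∈X+g) w∈X (∈-translate⁻ z∈X+g) (x∙yz≈y∙xz z w (g ⁻¹))
    ... | inj₁ (z≡w , _)    = z≡w
    ... | inj₂ (z≡z//g , _) =
      contradiction (⁻¹-injective (trans (identityʳ-unique z (g ⁻¹) (sym z≡z//g)) (sym ε⁻¹≈ε))) g≢ε

module Isoperimetry {n} (G : FinAbGroup n) (S H : Subset n) (ε∈S : FinAbGroup.0g G ∈ S)
                    (H-subgroup : IsSubgroup G H) (S⊆H : S ⊆ H) where

  open Sumsets G
  open AbelianGroup (abelianGroup G) using (_∙_; ε; _⁻¹; comm; identityˡ; inverseʳ; group)
  open Group group using (_//_)
  open AbelianGroupProperties (abelianGroup G)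

  ε∈H : ε ∈ H
  ε∈H = proj₁ H-subgroup

  ∙-closed : ∀ {x y} → x ∈ H → y ∈ H → x ∙ y ∈ H
  ∙-closed = proj₁ (proj₂ H-subgroup)

  ⁻¹-closed : ∀ {x} → x ∈ H → x ⁻¹ ∈ H
  ⁻¹-closed = proj₂ (proj₂ H-subgroup)

  ⊕-⊆H : ∀ {X Y} → X ⊆ H → Y ⊆ H → X ⊕ Y ⊆ H
  ⊕-⊆H X⊆H Y⊆H z∈X⊕Y with ∈-sumset⁻ z∈X⊕Y
  ... | _ , _ , x∈X , y∈Y , refl = ∙-closed (X⊆H x∈X) (Y⊆H y∈Y)

  ⊖-⊆H : ∀ {X} → X ⊆ H → ⊖ X ⊆ H
  ⊖-⊆H X⊆H {x} x∈⊖X = subst (_∈ H) (⁻¹-involutive x) (⁻¹-closed (X⊆H (∈-preimage⁻ x∈⊖X)))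

  ∂ : Subset n → ℕ
  ∂ X = ∣ X ⊕ S ∣ ∸ ∣ X ∣

  ∣X⊕S∣≡∣X∣+∂X : ∀ X → ∣ X ⊕ S ∣ ≡ ∣ X ∣ + ∂ X
  ∣X⊕S∣≡∣X∣+∂X X = sym (m+[n∸m]≡n (p⊆q⇒∣p∣≤∣q∣ (X⊆X⊕Y ε∈S)))

  ∣X⊕S∣≤∣X∣+k⇒∂X≤k : ∀ {X k} → ∣ X ⊕ S ∣ ≤ ∣ X ∣ + k → ∂ X ≤ k
  ∣X⊕S∣≤∣X∣+k⇒∂X≤k {X} = m≤n+o⇒m∸n≤o ∣ X ⊕ S ∣ ∣ X ∣

  ∂-translate : ∀ X c → ∂ (translate G X c) ≡ ∂ X
  ∂-translate X c = cong₂ _∸_ (∣translate⊕∣ X S c) (∣translate∣ X c)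

  subgroup⇒∣A∣≤∂A : ∀ {A c} → IsSubgroup G A → c ∈ S → c ∉ A → ∣ A ∣ ≤ ∂ A
  subgroup⇒∣A∣≤∂A {A} {c} (_ , ∙-closedᴬ , ⁻¹-closedᴬ) c∈S c∉A = +-cancelˡ-≤ (∣ A ∣) (∣ A ∣) (∂ A) (begin
    ∣ A ∣ + ∣ A ∣                ≡⟨ cong (∣ A ∣ +_) (∣translate∣ A c) ⟨
    ∣ A ∣ + ∣ translate G A c ∣  ≤⟨ disjoint⇒∣p∣+∣q∣≤∣r∣ {p = A} {translate G A c} {A ⊕ S}
                                      (X⊆X⊕Y ε∈S) (⊕-monoʳ (x∈p⇒⁅x⁆⊆p c∈S)) A∩A+c-empty ⟩
    ∣ A ⊕ S ∣                    ≡⟨ ∣X⊕S∣≡∣X∣+∂X A ⟩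
    ∣ A ∣ + ∂ A                  ∎)
    where
    open ≤-Reasoning
    A∩A+c-empty : Empty (A ∩ translate G A c)
    A∩A+c-empty (z , z∈) with x∈p∩q⁻ A (translate G A c) z∈
    ... | z∈A , z∈A+c =
      c∉A (subst (_∈ A) z∙[z//c]⁻¹≡c (∙-closedᴬ z∈A (⁻¹-closedᴬ (∈-translate⁻ z∈A+c))))
      where
      z∙[z//c]⁻¹≡c : z ∙ (z // c) ⁻¹ ≡ c
      z∙[z//c]⁻¹≡c = trans (cong (z ∙_) (⁻¹-anti-homo-// z c))
                            (trans (comm z (c // z)) (//-rightDividesˡ z c))

  ∣X∣<∣S∣⇒∣S∣≤1+∂X : (∀ g → g ≢ ε → ∣ translate G S g ∩ S ∣ ≤ 2) →
                      ∀ {X} → Nonempty X → ∣ X ∣ < ∣ S ∣ → ∣ S ∣ ≤ suc (∂ X)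
  ∣X∣<∣S∣⇒∣S∣≤1+∂X overlap≤2 {X} X-nonempty ∣X∣<∣S∣ = a*s≤a+k+2*[aC2]⇒s≤1+k {∣ X ∣} {∣ S ∣} {∂ X}
    (Nonempty⇒∣p∣>0 X-nonempty) ∣X∣<∣S∣ (begin
      ∣ X ∣ * ∣ S ∣                  ≤⟨ ∣X∣*∣Y∣≤∣X⊕Y∣+c*[∣X∣C2] S (∣Y+x∩Y+x′∣≤c S overlap≤2) X ⟩
      ∣ X ⊕ S ∣ + 2 * (∣ X ∣ C 2)    ≡⟨ cong (_+ 2 * (∣ X ∣ C 2)) (∣X⊕S∣≡∣X∣+∂X X) ⟩
      ∣ X ∣ + ∂ X + 2 * (∣ X ∣ C 2)  ∎)
    where open ≤-Reasoning

  IsFragment : Subset n → Set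
  IsFragment X = X ⊆ H × Nonempty X × ∣ X ⊕ S ∣ < ∣ H ∣

  isFragment? : Decidable IsFragment
  isFragment? X = X ⊆? H ×-dec nonempty? X ×-dec ∣ X ⊕ S ∣ <? ∣ H ∣

  admissible⇒fragment : ∀ {X} → Admissible G S H X → IsFragment X
  admissible⇒fragment (X⊆H , 0<∣X∣ , ∣X⊕S∣≤∣H∣-1) =
    X⊆H , ∣p∣>0⇒Nonempty 0<∣X∣ , m≤n∸1⇒m<n (<-≤-trans 0<∣X∣ (p⊆q⇒∣p∣≤∣q∣ (X⊆X⊕Y ε∈S))) ∣X⊕S∣≤∣H∣-1

  translate-fragment : ∀ {X c} → c ∈ H → IsFragment X → IsFragment (translate G X c)
  translate-fragment {X} {c} c∈H (X⊆H , (x , x∈X) , ∣X⊕S∣<∣H∣) =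
    ⊕-⊆H X⊆H (x∈p⇒⁅x⁆⊆p c∈H) , (x ∙ c , ∈-translate⁺ c x∈X) ,
    subst (_< ∣ H ∣) (sym (∣translate⊕∣ X S c)) ∣X⊕S∣<∣H∣

  ∩-fragment : ∀ {A B} → IsFragment A → Nonempty (A ∩ B) → IsFragment (A ∩ B)
  ∩-fragment {A} {B} (A⊆H , _ , ∣A⊕S∣<∣H∣) A∩B-nonempty =
    A⊆H ∘ p∩q⊆p A B , A∩B-nonempty , ≤-<-trans (p⊆q⇒∣p∣≤∣q∣ (⊕-monoˡ (p∩q⊆p A B))) ∣A⊕S∣<∣H∣

  dual : Subset n → Subset n
  dual X = ⊖ (H ─ (X ⊕ S))

  ∣dual∣+∣X⊕S∣≡∣H∣ : ∀ {X} → X ⊆ H → ∣ dual X ∣ + ∣ X ⊕ S ∣ ≡ ∣ H ∣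
  ∣dual∣+∣X⊕S∣≡∣H∣ {X} X⊆H = begin
    ∣ dual X ∣ + ∣ X ⊕ S ∣           ≡⟨ cong (_+ ∣ X ⊕ S ∣) (∣⊖X∣≡∣X∣ (H ─ (X ⊕ S))) ⟩
    ∣ H ─ (X ⊕ S) ∣ + ∣ X ⊕ S ∣      ≡⟨ +-comm ∣ H ─ (X ⊕ S) ∣ ∣ X ⊕ S ∣ ⟩
    ∣ X ⊕ S ∣ + ∣ H ─ (X ⊕ S) ∣      ≡⟨ ∣q∣+∣p─q∣≡∣p∣ (⊕-⊆H X⊆H S⊆H) ⟩
    ∣ H ∣                            ∎
    where open ≡-Reasoning

  -- If y ∈ dual X, s ∈ S and x ∈ X had y + s = -x, then -y = x + s would lie in X + S.
  ∣dual⊕S∣+∣X∣≤∣H∣ : ∀ {X} → X ⊆ H → ∣ dual X ⊕ S ∣ + ∣ X ∣ ≤ ∣ H ∣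
  ∣dual⊕S∣+∣X∣≤∣H∣ {X} X⊆H = subst (λ k → ∣ dual X ⊕ S ∣ + k ≤ ∣ H ∣) (∣⊖X∣≡∣X∣ X)
    (disjoint⇒∣p∣+∣q∣≤∣r∣ (⊕-⊆H (⊖-⊆H (p─q⊆p H (X ⊕ S))) S⊆H) (⊖-⊆H X⊆H) disjoint)
    where
    disjoint : Empty ((dual X ⊕ S) ∩ ⊖ X)
    disjoint (w , w∈) with x∈p∩q⁻ (dual X ⊕ S) (⊖ X) w∈
    ... | w∈dual⊕S , w∈⊖X with ∈-sumset⁻ w∈dual⊕S
    ...   | y , s , y∈dual , s∈S , refl = x∈p─q⇒x∉q {p = H} (∈-preimage⁻ {p = H ─ (X ⊕ S)} y∈dual)
      (subst (_∈ X ⊕ S) (trans (cong (_∙ s) (sym (⁻¹-∙-comm y s))) (//-rightDividesˡ s (y ⁻¹)))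
        (∈-sumset⁺ (∈-preimage⁻ w∈⊖X) s∈S))

  dual-fragment : ∀ {X} → IsFragment X → IsFragment (dual X) × ∂ (dual X) ≤ ∂ X
  dual-fragment {X} (X⊆H , X-nonempty , ∣X⊕S∣<∣H∣) =
    (⊖-⊆H (p─q⊆p H (X ⊕ S)) , dual-nonempty , ∣dual⊕S∣<∣H∣) , ∣X⊕S∣≤∣X∣+k⇒∂X≤k ∣dual⊕S∣≤∣dual∣+∂X
    where
    Y = dual X
    dual-nonempty : Nonempty Y
    dual-nonempty = ∣p∣>0⇒Nonempty (+-cancelʳ-< (∣ X ⊕ S ∣) 0 (∣ Y ∣)
      (subst (∣ X ⊕ S ∣ <_) (sym (∣dual∣+∣X⊕S∣≡∣H∣ X⊆H)) ∣X⊕S∣<∣H∣))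
    ∣dual⊕S∣<∣H∣ : ∣ Y ⊕ S ∣ < ∣ H ∣
    ∣dual⊕S∣<∣H∣ = <-≤-trans (m<m+n ∣ Y ⊕ S ∣ (Nonempty⇒∣p∣>0 X-nonempty)) (∣dual⊕S∣+∣X∣≤∣H∣ X⊆H)
    ∣dual⊕S∣≤∣dual∣+∂X : ∣ Y ⊕ S ∣ ≤ ∣ Y ∣ + ∂ X
    ∣dual⊕S∣≤∣dual∣+∂X = +-cancelʳ-≤ (∣ X ∣) _ _ (begin
      ∣ Y ⊕ S ∣ + ∣ X ∣      ≤⟨ ∣dual⊕S∣+∣X∣≤∣H∣ X⊆H ⟩
      ∣ H ∣                  ≡⟨ ∣dual∣+∣X⊕S∣≡∣H∣ X⊆H ⟨
      ∣ Y ∣ + ∣ X ⊕ S ∣      ≡⟨ cong (∣ Y ∣ +_) (trans (∣X⊕S∣≡∣X∣+∂X X) (+-comm (∣ X ∣) (∂ X))) ⟩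
      ∣ Y ∣ + (∂ X + ∣ X ∣)  ≡⟨ +-assoc (∣ Y ∣) (∂ X) (∣ X ∣) ⟨
      ∣ Y ∣ + ∂ X + ∣ X ∣    ∎)
      where open ≤-Reasoning

  record IsAtom (A : Subset n) : Set where
    field
      fragment   : IsFragment A
      ∂-minimal  : ∀ {X} → IsFragment X → ∂ A ≤ ∂ X
      ∣∣-minimal : ∀ {X} → IsFragment X → ∂ X ≤ ∂ A → ∣ A ∣ ≤ ∣ X ∣

  open IsAtom

  atom-exists : ∀ {X} → IsFragment X → ∃ IsAtom
  atom-exists X-fragment with argmin isFragment? ∂ X-fragment
  ... | X₀ , X₀-fragment , X₀-minimal
    with argmin (λ Y → isFragment? Y ×-dec ∂ Y ≤? ∂ X₀) ∣_∣ (X₀-fragment , ≤-refl)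
  ... | A , (A-fragment , ∂A≤∂X₀) , A-minimal = A , record
    { fragment   = A-fragment
    ; ∂-minimal  = λ X-fragment → ≤-trans ∂A≤∂X₀ (X₀-minimal X-fragment)
    ; ∣∣-minimal = λ X-fragment ∂X≤∂A → A-minimal (X-fragment , ≤-trans ∂X≤∂A ∂A≤∂X₀)
    }

  translate-atom : ∀ {A c} → c ∈ H → IsAtom A → IsAtom (translate G A c)
  translate-atom {A} {c} c∈H A-atom = record
    { fragment   = translate-fragment c∈H (fragment A-atom)
    ; ∂-minimal  = λ {X} X-fragment → subst (_≤ ∂ X) (sym (∂-translate A c)) (∂-minimal A-atom X-fragment)
    ; ∣∣-minimal = λ {X} X-fragment ∂X≤∂A+c → subst (_≤ ∣ X ∣) (sym (∣translate∣ A c))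
        (∣∣-minimal A-atom X-fragment (subst (∂ X ≤_) (∂-translate A c) ∂X≤∂A+c))
    }

  atoms-∂≡ : ∀ {A B} → IsAtom A → IsAtom B → ∂ A ≡ ∂ B
  atoms-∂≡ A-atom B-atom = ≤-antisym (∂-minimal A-atom (fragment B-atom)) (∂-minimal B-atom (fragment A-atom))

  -- Otherwise the dual of B would be a fragment with |A| + |B + S| ≤ |H|, and
  -- submodularity would squeeze |(A ∩ B) + S| below ∂ A.
  atoms-meet⇒∣A∪B⊕S∣<∣H∣ : ∀ {A B} → IsAtom A → IsAtom B → Nonempty (A ∩ B) → ∣ (A ∪ B) ⊕ S ∣ < ∣ H ∣
  atoms-meet⇒∣A∪B⊕S∣<∣H∣ {A} {B} A-atom B-atom A∩B-nonempty = ≰⇒> H≰A∪B⊕S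
    where
    I = A ∩ B
    ∣A∣+∣B⊕S∣≤∣H∣ : ∣ A ∣ + ∣ B ⊕ S ∣ ≤ ∣ H ∣
    ∣A∣+∣B⊕S∣≤∣H∣ = begin
      ∣ A ∣ + ∣ B ⊕ S ∣          ≤⟨ +-monoˡ-≤ ∣ B ⊕ S ∣ (∣∣-minimal A-atom dual-B-fragment ∂[dualB]≤∂A) ⟩
      ∣ dual B ∣ + ∣ B ⊕ S ∣     ≡⟨ ∣dual∣+∣X⊕S∣≡∣H∣ (proj₁ (fragment B-atom)) ⟩
      ∣ H ∣                      ∎
      where
      open ≤-Reasoning
      dual-B-fragment = proj₁ (dual-fragment (fragment B-atom))
      ∂[dualB]≤∂A = subst (∂ (dual B) ≤_) (atoms-∂≡ B-atom A-atom) (proj₂ (dual-fragment (fragment B-atom)))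
    ∂A<∣I⊕S∣ : ∂ A < ∣ I ⊕ S ∣
    ∂A<∣I⊕S∣ = begin-strict
      ∂ A         ≤⟨ ∂-minimal A-atom (∩-fragment (fragment A-atom) A∩B-nonempty) ⟩
      ∂ I         <⟨ m<n+m (∂ I) (Nonempty⇒∣p∣>0 A∩B-nonempty) ⟩
      ∣ I ∣ + ∂ I ≡⟨ ∣X⊕S∣≡∣X∣+∂X I ⟨
      ∣ I ⊕ S ∣   ∎
      where open ≤-Reasoning
    H≰A∪B⊕S : ¬ (∣ H ∣ ≤ ∣ (A ∪ B) ⊕ S ∣)
    H≰A∪B⊕S H≤A∪B⊕S = <⇒≱ ∂A<∣I⊕S∣ (+-cancelˡ-≤ (∣ H ∣) _ _ (begin
      ∣ H ∣ + ∣ I ⊕ S ∣                 ≤⟨ +-monoˡ-≤ ∣ I ⊕ S ∣ H≤A∪B⊕S ⟩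
      ∣ (A ∪ B) ⊕ S ∣ + ∣ I ⊕ S ∣       ≤⟨ submodular A B S ⟩
      ∣ A ⊕ S ∣ + ∣ B ⊕ S ∣             ≡⟨ cong (_+ ∣ B ⊕ S ∣) (∣X⊕S∣≡∣X∣+∂X A) ⟩
      ∣ A ∣ + ∂ A + ∣ B ⊕ S ∣           ≡⟨ +-rightComm (∣ A ∣) (∂ A) (∣ B ⊕ S ∣) ⟩
      ∣ A ∣ + ∣ B ⊕ S ∣ + ∂ A           ≤⟨ +-monoˡ-≤ (∂ A) ∣A∣+∣B⊕S∣≤∣H∣ ⟩
      ∣ H ∣ + ∂ A                       ∎))
      where open ≤-Reasoning

  atoms-meet⇒⊆ : ∀ {A B} → IsAtom A → IsAtom B → Nonempty (A ∩ B) → A ⊆ B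
  atoms-meet⇒⊆ {A} {B} A-atom B-atom A∩B-nonempty {x} x∈A = p∩q⊆q A B (subst (x ∈_) (sym I≡A) x∈A)
    where
    U = A ∪ B
    I = A ∩ B
    κ = ∂ A
    U-fragment : IsFragment U
    U-fragment = (λ x∈U → [ proj₁ (fragment A-atom) , proj₁ (fragment B-atom) ] (x∈p∪q⁻ A B x∈U))
               , (x , x∈p∪q⁺ (inj₁ x∈A)) , atoms-meet⇒∣A∪B⊕S∣<∣H∣ A-atom B-atom A∩B-nonempty
    ∣I⊕S∣≤∣I∣+κ : ∣ I ⊕ S ∣ ≤ ∣ I ∣ + κ
    ∣I⊕S∣≤∣I∣+κ = +-cancelˡ-≤ (∣ U ∣ + κ) _ _ (begin
      ∣ U ∣ + κ + ∣ I ⊕ S ∣      ≤⟨ +-monoˡ-≤ ∣ I ⊕ S ∣ (+-monoʳ-≤ ∣ U ∣ (∂-minimal A-atom U-fragment)) ⟩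
      ∣ U ∣ + ∂ U + ∣ I ⊕ S ∣    ≡⟨ cong (_+ ∣ I ⊕ S ∣) (∣X⊕S∣≡∣X∣+∂X U) ⟨
      ∣ U ⊕ S ∣ + ∣ I ⊕ S ∣      ≤⟨ submodular A B S ⟩
      ∣ A ⊕ S ∣ + ∣ B ⊕ S ∣      ≡⟨ cong₂ _+_ (∣X⊕S∣≡∣X∣+∂X A)
                                      (trans (∣X⊕S∣≡∣X∣+∂X B) (cong (∣ B ∣ +_) (atoms-∂≡ B-atom A-atom))) ⟩
      ∣ A ∣ + κ + (∣ B ∣ + κ)    ≡⟨ +-interchange (∣ A ∣) κ (∣ B ∣) κ ⟩
      ∣ A ∣ + ∣ B ∣ + (κ + κ)    ≡⟨ cong (_+ (κ + κ)) (∣p∪q∣+∣p∩q∣≡∣p∣+∣q∣ A B) ⟨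
      ∣ U ∣ + ∣ I ∣ + (κ + κ)    ≡⟨ +-interchange (∣ U ∣) (∣ I ∣) κ κ ⟩
      ∣ U ∣ + κ + (∣ I ∣ + κ)    ∎)
      where open ≤-Reasoning
    I≡A : I ≡ A
    I≡A = p⊆q∧∣q∣≤∣p∣⇒p≡q (p∩q⊆p A B)
      (∣∣-minimal A-atom (∩-fragment (fragment A-atom) A∩B-nonempty) (∣X⊕S∣≤∣X∣+k⇒∂X≤k ∣I⊕S∣≤∣I∣+κ))

  atom∋ε : ∀ {A} → IsAtom A → ∃[ A′ ] IsAtom A′ × ε ∈ A′
  atom∋ε {A} A-atom with fragment A-atom
  ... | A⊆H , (a , a∈A) , _ =
    translate G A (a ⁻¹) , translate-atom (⁻¹-closed (A⊆H a∈A)) A-atom ,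
    subst (_∈ translate G A (a ⁻¹)) (inverseʳ a) (∈-translate⁺ (a ⁻¹) a∈A)

  -- For a ∈ A, the atom A - a meets A in 0, hence equals A.
  atom∋ε⇒subgroup : ∀ {A} → IsAtom A → ε ∈ A → IsSubgroup G A
  atom∋ε⇒subgroup {A} A-atom ε∈A = ε∈A , ∙-closedᴬ , ⁻¹-closedᴬ
    where
    A≡A-a : ∀ {a} → a ∈ A → A ≡ translate G A (a ⁻¹)
    A≡A-a {a} a∈A = p⊆q∧∣q∣≤∣p∣⇒p≡q (atoms-meet⇒⊆ A-atom A-a-atom (ε , x∈p∩q⁺ (ε∈A , ε∈A-a)))
                                     (≤-reflexive (∣translate∣ A (a ⁻¹)))
      where
      A-a-atom = translate-atom (⁻¹-closed (proj₁ (fragment A-atom) a∈A)) A-atom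
      ε∈A-a = subst (_∈ translate G A (a ⁻¹)) (inverseʳ a) (∈-translate⁺ (a ⁻¹) a∈A)
    ∙-closedᴬ : ∀ {x a} → x ∈ A → a ∈ A → x ∙ a ∈ A
    ∙-closedᴬ {x} {a} x∈A a∈A =
      subst (_∈ A) (cong (x ∙_) (⁻¹-involutive a)) (∈-translate⁻ (subst (x ∈_) (A≡A-a a∈A) x∈A))
    ⁻¹-closedᴬ : ∀ {a} → a ∈ A → a ⁻¹ ∈ A
    ⁻¹-closedᴬ {a} a∈A = subst (a ⁻¹ ∈_) (sym (A≡A-a a∈A))
      (subst (_∈ translate G A (a ⁻¹)) (identityˡ (a ⁻¹)) (∈-translate⁺ (a ⁻¹) ε∈A))

  module _ (H-minimal : ∀ K → IsSubgroup G K → S ⊆ K → H ⊆ K)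
           (overlap≤2 : ∀ g → g ≢ ε → ∣ translate G S g ∩ S ∣ ≤ 2) where

    atom∋ε⇒∣S∣≤1+∂A : ∀ {A} → IsAtom A → ε ∈ A → ∣ S ∣ ≤ suc (∂ A)
    atom∋ε⇒∣S∣≤1+∂A {A} A-atom ε∈A with fragment A-atom | suc ∣ A ∣ ≤? ∣ S ∣ | nonempty? (S ─ A)
    ... | _ , A-nonempty , _ | yes ∣A∣<∣S∣ | _ = ∣X∣<∣S∣⇒∣S∣≤1+∂X overlap≤2 A-nonempty ∣A∣<∣S∣
    ... | _ | no ∣A∣≮∣S∣ | yes (c , c∈S─A) = ≤-trans (≮⇒≥ ∣A∣≮∣S∣) (m≤n⇒m≤1+n
      (subgroup⇒∣A∣≤∂A (atom∋ε⇒subgroup A-atom ε∈A) (p─q⊆p S A c∈S─A) (x∈p─q⇒x∉q {p = S} c∈S─A)))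
    ... | _ , _ , ∣A⊕S∣<∣H∣ | no _ | no S─A-empty = contradiction ∣A⊕S∣<∣H∣ (≤⇒≯ (begin
      ∣ H ∣       ≤⟨ p⊆q⇒∣p∣≤∣q∣ (H-minimal A (atom∋ε⇒subgroup A-atom ε∈A) S⊆A) ⟩
      ∣ A ∣       ≤⟨ p⊆q⇒∣p∣≤∣q∣ (X⊆X⊕Y ε∈S) ⟩
      ∣ A ⊕ S ∣   ∎))
      where
      open ≤-Reasoning
      S⊆A : S ⊆ A
      S⊆A {c} c∈S with c ∈? A
      ... | yes c∈A = c∈A
      ... | no  c∉A = contradiction (c , x∈p∧x∉q⇒x∈p─q c∈S c∉A) S─A-empty

    fragment⇒∣S∣≤1+∂X : ∀ {X} → IsFragment X → ∣ S ∣ ≤ suc (∂ X)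
    fragment⇒∣S∣≤1+∂X X-fragment =
      let A , A-atom          = atom-exists X-fragment
          A′ , A′-atom , ε∈A′ = atom∋ε A-atom
      in ≤-trans (atom∋ε⇒∣S∣≤1+∂A A′-atom ε∈A′) (s≤s (∂-minimal A′-atom X-fragment))

    κ₁≡∣S∣∸1 : Kappa1 G S H (∣ S ∣ ∸ 1)
    κ₁≡∣S∣∸1 = from-separability (∣ S ∣ ≤? ∣ H ∣ ∸ 1)
      where
      open ≤-Reasoning
      ⁅ε⁆⊕S≡S = ⁅ε⁆⊕Y≡Y S
      from-separability : Dec (∣ S ∣ ≤ ∣ H ∣ ∸ 1) → Kappa1 G S H (∣ S ∣ ∸ 1)
      from-separability (yes ∣S∣≤∣H∣-1) =
        inj₁ ((⁅ ε ⁆ , ⁅ε⁆-admissible) , (⁅ ε ⁆ , ⁅ε⁆-admissible , ∂⁅ε⁆≡∣S∣∸1) , ∣S∣∸1≤∂)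
        where
        ⁅ε⁆-admissible : Admissible G S H ⁅ ε ⁆
        ⁅ε⁆-admissible = x∈p⇒⁅x⁆⊆p ε∈H , ≤-reflexive (sym (∣⁅x⁆∣≡1 ε))
                       , subst (λ X → ∣ X ∣ ≤ ∣ H ∣ ∸ 1) (sym ⁅ε⁆⊕S≡S) ∣S∣≤∣H∣-1
        ∂⁅ε⁆≡∣S∣∸1 : ∂ ⁅ ε ⁆ ≡ ∣ S ∣ ∸ 1
        ∂⁅ε⁆≡∣S∣∸1 = cong₂ _∸_ (cong ∣_∣ ⁅ε⁆⊕S≡S) (∣⁅x⁆∣≡1 ε)
        ∣S∣∸1≤∂ : ∀ X → Admissible G S H X → ∣ S ∣ ∸ 1 ≤ ∂ X
        ∣S∣∸1≤∂ X X-admissible = ∸-monoˡ-≤ 1 (fragment⇒∣S∣≤1+∂X (admissible⇒fragment X-admissible))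
      from-separability (no ∣S∣≰∣H∣-1) = inj₂ (not-separable , refl)
        where
        not-separable : ¬ OneSeparable G S H
        not-separable (X , X-admissible@(_ , 0<∣X∣ , ∣X⊕S∣≤∣H∣-1)) = ∣S∣≰∣H∣-1 (begin
          ∣ S ∣         ≤⟨ fragment⇒∣S∣≤1+∂X (admissible⇒fragment X-admissible) ⟩
          suc (∂ X)     ≤⟨ +-monoˡ-≤ (∂ X) 0<∣X∣ ⟩
          ∣ X ∣ + ∂ X   ≡⟨ ∣X⊕S∣≡∣X∣+∂X X ⟨
          ∣ X ⊕ S ∣     ≤⟨ ∣X⊕S∣≤∣H∣-1 ⟩
          ∣ H ∣ ∸ 1     ∎)

lemma2p7 : ∀ (n : ℕ) (G : FinAbGroup n) →
    (∀ (S : Subset n) → Generates G S → FinAbGroup.0g G ∈ S → 3 ≤ ∣ S ∣ →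
      (∀ g → ¬ g ≡ FinAbGroup.0g G → ∣ translate G S g ∩ S ∣ ≤ 2) →
      Kappa1 G S ⊤ (∣ S ∣ ∸ 1))
    × (∀ (X H : Subset n) → IsSidon G X → FinAbGroup.0g G ∈ X →
      IsGeneratedBy G X H → Kappa1 G X H (∣ X ∣ ∸ 1))
lemma2p7 n G =
    (λ S (⊤-subgroup , S⊆⊤ , ⊤-minimal) ε∈S _ overlap≤2 →
       Isoperimetry.κ₁≡∣S∣∸1 G S ⊤ ε∈S ⊤-subgroup S⊆⊤ ⊤-minimal overlap≤2)
  , (λ X H sidon ε∈X (H-subgroup , X⊆H , H-minimal) →
       Isoperimetry.κ₁≡∣S∣∸1 G X H ε∈X H-subgroup X⊆H H-minimal
         (λ g g≢ε → ≤-trans (Sumsets.Sidon⇒∣X+g∩X∣≤1 G sidon g≢ε) (n≤1+n 1)))
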